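{- Let $n$ be a positive integer. (1) The $n$-periodic elements of any $\ell$-pregroup form a subalgebra, which is an $n$-periodic $\ell$-pregroup. (2) For every chain $\Omega$, $\mathbf{F}_n(\Omega)$ is an $n$-periodic subalgebra of $\mathbf{F}(\Omega)$.
   Context: An $\ell$-pregroup is an algebra $(A,\wedge,\vee,\cdot,{}^{\ell},{}^{r},1)$ with lattice reduct, monoid reduct, order-preserving multiplication, and $x^{\ell}x\le 1\le xx^{\ell}$, $xx^{r}\le 1\le x^{r}x$. An element $x$ is $n$-periodic if $x^{\ell^n}=x^{r^n}$; an $\ell$-pregroup is $n$-periodic if all its elements are. For a chain $\Omega$, $\mathbf{F}(\Omega)$ is the $\ell$-pregroup of maps on $\Omega$ having residuals ($f^r(b)=\max\{a:f(a)\le b\}$) and dual residuals ($f^\ell(a)=\min\{b:a\le f(b)\}$) of all orders, under composition, identity, pointwise order, ${}^\ell,{}^r$; $F_n(\Omega)$ denotes the set of $n$-periodic elements of $\mathbf{F}(\Omega)$. -}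

module Defs where

open import Level using (Level; _⊔_) renaming (suc to lsuc)
open import Data.Nat using (ℕ; zero; suc)
open import Data.Integer using (ℤ; +_; -_) renaming (_+_ to _+ℤ_)
open import Data.Product using (Σ; _×_; _,_)
open import Relation.Binary using (Rel; TotalOrder)
open import Algebra.Structures using (IsMonoid)
open import Algebra.Lattice.Structures using (IsLattice)

record LPregroup (c ℓ : Level) : Set (lsuc (c ⊔ ℓ)) where
  infixr 7 _·_
  infixr 6 _∧_
  infixr 5 _∨_
  infix 4 _≈_ _≤_
  field
    Carrier : Set c
    _≈_     : Rel Carrier ℓ
    _∧_     : Carrier → Carrier → Carrier
    _∨_     : Carrier → Carrier → Carrier
    _·_     : Carrier → Carrier → Carrier
    lad     : Carrier → Carrier
    rad     : Carrier → Carrier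
    one     : Carrier
    isLattice : IsLattice _≈_ _∨_ _∧_
    isMonoid  : IsMonoid _≈_ _·_ one
    lad-cong  : ∀ {x y} → x ≈ y → lad x ≈ lad y
    rad-cong  : ∀ {x y} → x ≈ y → rad x ≈ rad y

  _≤_ : Rel Carrier ℓ
  x ≤ y = x ≈ x ∧ y

  field
    ·-monoˡ : ∀ {x y} z → x ≤ y → x · z ≤ y · z
    ·-monoʳ : ∀ {x y} z → x ≤ y → z · x ≤ z · y
    lad-contr : ∀ x → lad x · x ≤ one
    lad-exp   : ∀ x → one ≤ x · lad x
    rad-contr : ∀ x → x · rad x ≤ one
    rad-exp   : ∀ x → one ≤ rad x · x

  lad^ : ℕ → Carrier → Carrier
  lad^ zero x = x
  lad^ (suc n) x = lad (lad^ n x)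

  rad^ : ℕ → Carrier → Carrier
  rad^ zero x = x
  rad^ (suc n) x = rad (rad^ n x)

  Periodic : ℕ → Carrier → Set ℓ
  Periodic n x = lad^ n x ≈ rad^ n x

  record IsSubalgebra {p} (P : Carrier → Set p) : Set (c ⊔ p) where
    field
      ∧-closed   : ∀ {x y} → P x → P y → P (x ∧ y)
      ∨-closed   : ∀ {x y} → P x → P y → P (x ∨ y)
      ·-closed   : ∀ {x y} → P x → P y → P (x · y)
      lad-closed : ∀ {x} → P x → P (lad x)
      rad-closed : ∀ {x} → P x → P (rad x)
      one-closed : P one

-- An element of F(Ω) is a map f together with the (ℤ-indexed) sequence of
-- its iterated residuals / dual residuals:
--   seq 0 = f, seq (k+1) = (seq k)^r, seq (k-1) = (seq k)^ℓ,
-- characterised by the adjunction  seq k a ≤ b  ⇔  a ≤ seq (k+1) b,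
-- which says exactly seq (k+1) b = max{a : seq k a ≤ b}
-- and seq k a = min{b : a ≤ seq (k+1) b}.  (Adjoints are unique up to ≈.)

module FOn {c ℓ₁ ℓ₂} (Ω : TotalOrder c ℓ₁ ℓ₂) where
  open TotalOrder Ω renaming (Carrier to W)

  record FElt : Set (c ⊔ ℓ₂) where
    field
      seq : ℤ → W → W
      adj  : ∀ k a b → (seq k a ≤ b → a ≤ seq (k +ℤ + 1) b)
                     × (a ≤ seq (k +ℤ + 1) b → seq k a ≤ b)

    fun : W → W
    fun = seq (+ 0)

    ladF : W → W
    ladF = seq (- (+ 1))

    radF : W → W
    radF = seq (+ 1)

  open FElt public

  PeriodicF : ℕ → FElt → Set (c ⊔ ℓ₁)
  PeriodicF n f = ∀ a → seq f (- (+ n)) a ≈ seq f (+ n) a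

  IsPtMeet : FElt → FElt → FElt → Set (c ⊔ ℓ₂)
  IsPtMeet f g h = ∀ a → fun h a ≤ fun f a × fun h a ≤ fun g a
                       × (∀ w → w ≤ fun f a → w ≤ fun g a → w ≤ fun h a)

  IsPtJoin : FElt → FElt → FElt → Set (c ⊔ ℓ₂)
  IsPtJoin f g h = ∀ a → fun f a ≤ fun h a × fun g a ≤ fun h a
                       × (∀ w → fun f a ≤ w → fun g a ≤ w → fun h a ≤ w)

  record IsFSubalgebra {p} (P : FElt → Set p) : Set (c ⊔ ℓ₁ ⊔ ℓ₂ ⊔ p) where
    field
      ∧-closed   : ∀ {f g} → P f → P g → Σ FElt λ h → IsPtMeet f g h × P h
      ∨-closed   : ∀ {f g} → P f → P g → Σ FElt λ h → IsPtJoin f g h × P h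
      ∘-closed   : ∀ {f g} → P f → P g →
                   Σ FElt λ h → (∀ a → fun h a ≈ fun f (fun g a)) × P h
      id-closed  : Σ FElt λ h → (∀ a → fun h a ≈ a) × P h
      lad-closed : ∀ {f} → P f → Σ FElt λ h → (∀ a → fun h a ≈ ladF f a) × P h
      rad-closed : ∀ {f} → P f → Σ FElt λ h → (∀ a → fun h a ≈ radF f a) × P h

module Submission where

-- (1) As ^ℓ and ^r are mutually inverse, x^{ℓⁿ} ≈ x^{rⁿ} holds iff x is fixed by the n-th
-- iterate of x ↦ x^{rr}.  Since x ↦ x^r is an order-reversing bijection that reverses
-- products, x ↦ x^{rr} is an endomorphism of the ℓ-pregroup, and the fixed points of an
-- endomorphism form a subalgebra.
-- (2) The k-th residual of f ∧ g, f ∨ g and f ∘ g is obtained from the k-th residuals of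
-- f and g by min or max, max or min, and composition in one order or the other, according
-- to the parity of k; as -n and n have the same parity, n-periodicity passes to them.  The
-- residual sequences of f^ℓ and f^r are shifts of that of f, and periodicity passes to them
-- because adjoints of equal maps are equal.

open import Defs
open import Level using () renaming (_⊔_ to _⊔ˡ_)
open import Data.Nat using (ℕ; zero; suc; parity)
import Data.Nat.Properties as ℕ
open import Data.Integer using (ℤ; +_; -[1+_]; -_; ∣_∣) renaming (_+_ to _+ℤ_)
import Data.Integer.Properties as ℤ
open import Data.Parity using (Parity; 0ℙ; 1ℙ; _⁻¹)
open import Data.Parity.Properties using (suc-homo-⁻¹; ⁻¹-selfInverse)
open import Data.Product using (_×_; _,_; proj₁; proj₂)
open import Data.Sum using (inj₁; inj₂)
open import Function using (_∘_; id)
open import Relation.Binary using (TotalOrder; _Preserves_⟶_)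
open import Relation.Binary.PropositionalEquality as ≡ using (_≡_)
open import Algebra.Structures using (IsMonoid)
open import Algebra.Lattice.Bundles using (Lattice)
open import Algebra.Lattice.Structures using (IsLattice)
import Algebra.Lattice.Properties.Lattice as LatticeProperties
open import Algebra.Properties.CommutativeSemigroup ℤ.+-commutativeSemigroup using (xy∙z≈xz∙y)
import Relation.Binary.Lattice.Structures as OrderLattice
import Relation.Binary.Reasoning.PartialOrder as ≤-Reasoning
open import Relation.Binary.Bundles using (Poset)

module PeriodicElements {c ℓ} (A : LPregroup c ℓ) where
  open LPregroup A

  private
    lattice : Lattice c ℓ
    lattice = record { isLattice = isLattice }

  open LatticeProperties lattice using (poset; ∨-∧-isOrderTheoreticLattice)
  open OrderLattice.IsLattice ∨-∧-isOrderTheoreticLattice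
    using (x∧y≤x; x∧y≤y; ∧-greatest; x≤x∨y; y≤x∨y; ∨-least)
  open Poset poset using (antisym; reflexive; module Eq) renaming (trans to ≤-trans)
  open IsLattice isLattice using (∧-cong; ∨-cong)
  open IsMonoid isMonoid using (assoc; identityˡ; identityʳ; ∙-cong)
  open ≤-Reasoning poset
  open import Function.Endo.Propositional Carrier using (_^_)

  lad-unique : ∀ x y → y · x ≤ one → one ≤ x · y → y ≈ lad x
  lad-unique x y yx≤1 1≤xy = antisym
    (begin
      y                 ≈⟨ identityʳ y ⟨
      y · one           ≤⟨ ·-monoʳ y (lad-exp x) ⟩
      y · (x · lad x)   ≈⟨ assoc y x (lad x) ⟨
      (y · x) · lad x   ≤⟨ ·-monoˡ (lad x) yx≤1 ⟩
      one · lad x       ≈⟨ identityˡ (lad x) ⟩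
      lad x             ∎)
    (begin
      lad x             ≈⟨ identityʳ (lad x) ⟨
      lad x · one       ≤⟨ ·-monoʳ (lad x) 1≤xy ⟩
      lad x · (x · y)   ≈⟨ assoc (lad x) x y ⟨
      (lad x · x) · y   ≤⟨ ·-monoˡ y (lad-contr x) ⟩
      one · y           ≈⟨ identityˡ y ⟩
      y                 ∎)

  rad-unique : ∀ x y → x · y ≤ one → one ≤ y · x → y ≈ rad x
  rad-unique x y xy≤1 1≤yx = antisym
    (begin
      y                 ≈⟨ identityˡ y ⟨
      one · y           ≤⟨ ·-monoˡ y (rad-exp x) ⟩
      (rad x · x) · y   ≈⟨ assoc (rad x) x y ⟩
      rad x · (x · y)   ≤⟨ ·-monoʳ (rad x) xy≤1 ⟩
      rad x · one       ≈⟨ identityʳ (rad x) ⟩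
      rad x             ∎)
    (begin
      rad x             ≈⟨ identityˡ (rad x) ⟨
      one · rad x       ≤⟨ ·-monoˡ (rad x) 1≤yx ⟩
      (y · x) · rad x   ≈⟨ assoc y x (rad x) ⟩
      y · (x · rad x)   ≤⟨ ·-monoʳ y (rad-contr x) ⟩
      y · one           ≈⟨ identityʳ y ⟩
      y                 ∎)

  rad-lad : ∀ x → rad (lad x) ≈ x
  rad-lad x = Eq.sym (rad-unique (lad x) x (lad-contr x) (lad-exp x))

  lad-rad : ∀ x → lad (rad x) ≈ x
  lad-rad x = Eq.sym (lad-unique (rad x) x (rad-contr x) (rad-exp x))

  rad-one : rad one ≈ one
  rad-one = Eq.sym (rad-unique one one
    (reflexive (identityˡ one)) (reflexive (Eq.sym (identityˡ one))))

  rad-· : ∀ x y → rad (x · y) ≈ rad y · rad x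
  rad-· x y = Eq.sym (rad-unique (x · y) (rad y · rad x) xy·ryrx≤1 1≤ryrx·xy)
    where
    xy·ryrx≤1 : (x · y) · (rad y · rad x) ≤ one
    xy·ryrx≤1 = begin
      (x · y) · (rad y · rad x)   ≈⟨ assoc x y (rad y · rad x) ⟩
      x · (y · (rad y · rad x))   ≈⟨ ∙-cong Eq.refl (assoc y (rad y) (rad x)) ⟨
      x · ((y · rad y) · rad x)   ≤⟨ ·-monoʳ x (·-monoˡ (rad x) (rad-contr y)) ⟩
      x · (one · rad x)           ≈⟨ ∙-cong Eq.refl (identityˡ (rad x)) ⟩
      x · rad x                   ≤⟨ rad-contr x ⟩
      one                         ∎
    1≤ryrx·xy : one ≤ (rad y · rad x) · (x · y)
    1≤ryrx·xy = begin
      one                         ≤⟨ rad-exp y ⟩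
      rad y · y                   ≈⟨ ∙-cong Eq.refl (identityˡ y) ⟨
      rad y · (one · y)           ≤⟨ ·-monoʳ (rad y) (·-monoˡ y (rad-exp x)) ⟩
      rad y · ((rad x · x) · y)   ≈⟨ ∙-cong Eq.refl (assoc (rad x) x y) ⟩
      rad y · (rad x · (x · y))   ≈⟨ assoc (rad y) (rad x) (x · y) ⟨
      (rad y · rad x) · (x · y)   ∎

  lad-antitone : ∀ {x y} → x ≤ y → lad y ≤ lad x
  lad-antitone {x} {y} x≤y = begin
    lad y                   ≈⟨ identityʳ (lad y) ⟨
    lad y · one             ≤⟨ ·-monoʳ (lad y) (lad-exp x) ⟩
    lad y · (x · lad x)     ≈⟨ assoc (lad y) x (lad x) ⟨
    (lad y · x) · lad x     ≤⟨ ·-monoˡ (lad x) (·-monoʳ (lad y) x≤y) ⟩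
    (lad y · y) · lad x     ≤⟨ ·-monoˡ (lad x) (lad-contr y) ⟩
    one · lad x             ≈⟨ identityˡ (lad x) ⟩
    lad x                   ∎

  rad-antitone : ∀ {x y} → x ≤ y → rad y ≤ rad x
  rad-antitone {x} {y} x≤y = begin
    rad y                   ≈⟨ identityˡ (rad y) ⟨
    one · rad y             ≤⟨ ·-monoˡ (rad y) (rad-exp x) ⟩
    (rad x · x) · rad y     ≤⟨ ·-monoˡ (rad y) (·-monoʳ (rad x) x≤y) ⟩
    (rad x · y) · rad y     ≈⟨ assoc (rad x) y (rad y) ⟩
    rad x · (y · rad y)     ≤⟨ ·-monoʳ (rad x) (rad-contr y) ⟩
    rad x · one             ≈⟨ identityʳ (rad x) ⟩
    rad x                   ∎

  module _ (f g : Carrier → Carrier)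
           (f-antitone : ∀ {x y} → x ≤ y → f y ≤ f x)
           (g-antitone : ∀ {x y} → x ≤ y → g y ≤ g x)
           (f∘g≈id : ∀ x → f (g x) ≈ x) (g∘f≈id : ∀ x → g (f x) ≈ x) where

    antitone-inverse-∧ : ∀ x y → f (x ∧ y) ≈ f x ∨ f y
    antitone-inverse-∧ x y =
      antisym f[x∧y]≤fx∨fy (∨-least (f-antitone (x∧y≤x x y)) (f-antitone (x∧y≤y x y)))
      where
      f[x∧y]≤fx∨fy : f (x ∧ y) ≤ f x ∨ f y
      f[x∧y]≤fx∨fy = begin
        f (x ∧ y)          ≤⟨ f-antitone (∧-greatest
                                (≤-trans (g-antitone (x≤x∨y (f x) (f y))) (reflexive (g∘f≈id x)))
                                (≤-trans (g-antitone (y≤x∨y (f x) (f y))) (reflexive (g∘f≈id y)))) ⟩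
        f (g (f x ∨ f y))  ≈⟨ f∘g≈id (f x ∨ f y) ⟩
        f x ∨ f y          ∎

    antitone-inverse-∨ : ∀ x y → f (x ∨ y) ≈ f x ∧ f y
    antitone-inverse-∨ x y =
      antisym (∧-greatest (f-antitone (x≤x∨y x y)) (f-antitone (y≤x∨y x y))) fx∧fy≤f[x∨y]
      where
      fx∧fy≤f[x∨y] : f x ∧ f y ≤ f (x ∨ y)
      fx∧fy≤f[x∨y] = begin
        f x ∧ f y          ≈⟨ f∘g≈id (f x ∧ f y) ⟨
        f (g (f x ∧ f y))  ≤⟨ f-antitone (∨-least
                                (≤-trans (reflexive (Eq.sym (g∘f≈id x))) (g-antitone (x∧y≤x (f x) (f y))))
                                (≤-trans (reflexive (Eq.sym (g∘f≈id y))) (g-antitone (x∧y≤y (f x) (f y))))) ⟩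
        f (x ∨ y)          ∎

  rad-∧ : ∀ x y → rad (x ∧ y) ≈ rad x ∨ rad y
  rad-∧ = antitone-inverse-∧ rad lad rad-antitone lad-antitone rad-lad lad-rad

  rad-∨ : ∀ x y → rad (x ∨ y) ≈ rad x ∧ rad y
  rad-∨ = antitone-inverse-∨ rad lad rad-antitone lad-antitone rad-lad lad-rad

  record IsEndomorphism (h : Carrier → Carrier) : Set (c ⊔ˡ ℓ) where
    field
      cong     : ∀ {x y} → x ≈ y → h x ≈ h y
      ∧-homo   : ∀ x y → h (x ∧ y) ≈ h x ∧ h y
      ∨-homo   : ∀ x y → h (x ∨ y) ≈ h x ∨ h y
      ·-homo   : ∀ x y → h (x · y) ≈ h x · h y
      one-homo : h one ≈ one
      lad-homo : ∀ x → h (lad x) ≈ lad (h x)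
      rad-homo : ∀ x → h (rad x) ≈ rad (h x)

  id-isEndomorphism : IsEndomorphism id
  id-isEndomorphism = record
    { cong     = id
    ; ∧-homo   = λ _ _ → Eq.refl
    ; ∨-homo   = λ _ _ → Eq.refl
    ; ·-homo   = λ _ _ → Eq.refl
    ; one-homo = Eq.refl
    ; lad-homo = λ _ → Eq.refl
    ; rad-homo = λ _ → Eq.refl
    }

  ∘-isEndomorphism : ∀ {h k} → IsEndomorphism h → IsEndomorphism k → IsEndomorphism (h ∘ k)
  ∘-isEndomorphism {k = k} H K = record
    { cong     = H.cong ∘ K.cong
    ; ∧-homo   = λ x y → Eq.trans (H.cong (K.∧-homo x y)) (H.∧-homo (k x) (k y))
    ; ∨-homo   = λ x y → Eq.trans (H.cong (K.∨-homo x y)) (H.∨-homo (k x) (k y))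
    ; ·-homo   = λ x y → Eq.trans (H.cong (K.·-homo x y)) (H.·-homo (k x) (k y))
    ; one-homo = Eq.trans (H.cong K.one-homo) H.one-homo
    ; lad-homo = λ x → Eq.trans (H.cong (K.lad-homo x)) (H.lad-homo (k x))
    ; rad-homo = λ x → Eq.trans (H.cong (K.rad-homo x)) (H.rad-homo (k x))
    }
    where
    module H = IsEndomorphism H
    module K = IsEndomorphism K

  ^-isEndomorphism : ∀ {h} → IsEndomorphism h → ∀ n → IsEndomorphism (h ^ n)
  ^-isEndomorphism H zero    = id-isEndomorphism
  ^-isEndomorphism H (suc n) = ∘-isEndomorphism H (^-isEndomorphism H n)

  rad²-isEndomorphism : IsEndomorphism (rad ∘ rad)
  rad²-isEndomorphism = record
    { cong     = rad-cong ∘ rad-cong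
    ; ∧-homo   = λ x y → Eq.trans (rad-cong (rad-∧ x y)) (rad-∨ (rad x) (rad y))
    ; ∨-homo   = λ x y → Eq.trans (rad-cong (rad-∨ x y)) (rad-∧ (rad x) (rad y))
    ; ·-homo   = λ x y → Eq.trans (rad-cong (rad-· x y)) (rad-· (rad y) (rad x))
    ; one-homo = Eq.trans (rad-cong rad-one) rad-one
    ; lad-homo = λ x → Eq.trans (rad-cong (rad-lad x)) (Eq.sym (lad-rad (rad x)))
    ; rad-homo = λ _ → Eq.refl
    }

  fixedPoints-isSubalgebra : ∀ {h} → IsEndomorphism h → IsSubalgebra (λ x → h x ≈ x)
  fixedPoints-isSubalgebra H = record
    { ∧-closed   = λ {x} {y} hx≈x hy≈y → Eq.trans (∧-homo x y) (∧-cong hx≈x hy≈y)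
    ; ∨-closed   = λ {x} {y} hx≈x hy≈y → Eq.trans (∨-homo x y) (∨-cong hx≈x hy≈y)
    ; ·-closed   = λ {x} {y} hx≈x hy≈y → Eq.trans (·-homo x y) (∙-cong hx≈x hy≈y)
    ; lad-closed = λ {x} hx≈x → Eq.trans (lad-homo x) (lad-cong hx≈x)
    ; rad-closed = λ {x} hx≈x → Eq.trans (rad-homo x) (rad-cong hx≈x)
    ; one-closed = one-homo
    }
    where open IsEndomorphism H

  isSubalgebra-resp : ∀ {p q} {P : Carrier → Set p} {Q : Carrier → Set q} →
                      (∀ {x} → P x → Q x) → (∀ {x} → Q x → P x) →
                      IsSubalgebra P → IsSubalgebra Q
  isSubalgebra-resp P⇒Q Q⇒P S = record
    { ∧-closed   = λ Qx Qy → P⇒Q (∧-closed (Q⇒P Qx) (Q⇒P Qy))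
    ; ∨-closed   = λ Qx Qy → P⇒Q (∨-closed (Q⇒P Qx) (Q⇒P Qy))
    ; ·-closed   = λ Qx Qy → P⇒Q (·-closed (Q⇒P Qx) (Q⇒P Qy))
    ; lad-closed = λ Qx → P⇒Q (lad-closed (Q⇒P Qx))
    ; rad-closed = λ Qx → P⇒Q (rad-closed (Q⇒P Qx))
    ; one-closed = P⇒Q one-closed
    }
    where open IsSubalgebra S

  lad^-cong : ∀ n {x y} → x ≈ y → lad^ n x ≈ lad^ n y
  lad^-cong zero    = id
  lad^-cong (suc n) = lad-cong ∘ lad^-cong n

  rad^-cong : ∀ n {x y} → x ≈ y → rad^ n x ≈ rad^ n y
  rad^-cong zero    = id
  rad^-cong (suc n) = rad-cong ∘ rad^-cong n

  lad^-lad : ∀ n x → lad^ n (lad x) ≡ lad^ (suc n) x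
  lad^-lad zero    x = ≡.refl
  lad^-lad (suc n) x = ≡.cong lad (lad^-lad n x)

  rad^-rad : ∀ n x → rad^ n (rad x) ≡ rad^ (suc n) x
  rad^-rad zero    x = ≡.refl
  rad^-rad (suc n) x = ≡.cong rad (rad^-rad n x)

  rad^-lad^ : ∀ n x → rad^ n (lad^ n x) ≈ x
  rad^-lad^ zero    x = Eq.refl
  rad^-lad^ (suc n) x = begin-equality
    rad (rad^ n (lad (lad^ n x)))  ≡⟨ ≡.cong rad (≡.cong (rad^ n) (lad^-lad n x)) ⟨
    rad (rad^ n (lad^ n (lad x)))  ≈⟨ rad-cong (rad^-lad^ n (lad x)) ⟩
    rad (lad x)                    ≈⟨ rad-lad x ⟩
    x                              ∎

  lad^-rad^ : ∀ n x → lad^ n (rad^ n x) ≈ x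
  lad^-rad^ zero    x = Eq.refl
  lad^-rad^ (suc n) x = begin-equality
    lad (lad^ n (rad (rad^ n x)))  ≡⟨ ≡.cong lad (≡.cong (lad^ n) (rad^-rad n x)) ⟨
    lad (lad^ n (rad^ n (rad x)))  ≈⟨ lad-cong (lad^-rad^ n (rad x)) ⟩
    lad (rad x)                    ≈⟨ lad-rad x ⟩
    x                              ∎

  rad^-rad^ : ∀ n x → rad^ n (rad^ n x) ≡ ((rad ∘ rad) ^ n) x
  rad^-rad^ zero    x = ≡.refl
  rad^-rad^ (suc n) x =
    ≡.cong rad (≡.trans (rad^-rad n (rad^ n x)) (≡.cong rad (rad^-rad^ n x)))

  periodic⇒fixed : ∀ n {x} → Periodic n x → ((rad ∘ rad) ^ n) x ≈ x
  periodic⇒fixed n {x} lad^x≈rad^x = begin-equality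
    ((rad ∘ rad) ^ n) x  ≡⟨ rad^-rad^ n x ⟨
    rad^ n (rad^ n x)    ≈⟨ rad^-cong n lad^x≈rad^x ⟨
    rad^ n (lad^ n x)    ≈⟨ rad^-lad^ n x ⟩
    x                    ∎

  fixed⇒periodic : ∀ n {x} → ((rad ∘ rad) ^ n) x ≈ x → Periodic n x
  fixed⇒periodic n {x} fixed = begin-equality
    lad^ n x                      ≈⟨ lad^-cong n fixed ⟨
    lad^ n (((rad ∘ rad) ^ n) x)  ≡⟨ ≡.cong (lad^ n) (rad^-rad^ n x) ⟨
    lad^ n (rad^ n (rad^ n x))    ≈⟨ lad^-rad^ n (rad^ n x) ⟩
    rad^ n x                      ∎

  periodic-isSubalgebra : ∀ n → IsSubalgebra (Periodic n)
  periodic-isSubalgebra n = isSubalgebra-resp (fixed⇒periodic n) (periodic⇒fixed n)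
    (fixedPoints-isSubalgebra (^-isEndomorphism rad²-isEndomorphism n))

parityℤ : ℤ → Parity
parityℤ k = parity ∣ k ∣

parity-suc : ∀ n → parity (suc n) ≡ parity n ⁻¹
parity-suc n = ≡.sym (⁻¹-selfInverse (suc-homo-⁻¹ n))

parityℤ-suc : ∀ k → parityℤ (k +ℤ + 1) ≡ parityℤ k ⁻¹
parityℤ-suc (+ n)          = ≡.trans (≡.cong parity (ℕ.+-comm n 1)) (parity-suc n)
parityℤ-suc -[1+ zero ]    = ≡.refl
parityℤ-suc -[1+ suc n ]   = parity-suc n

parityℤ-neg : ∀ k → parityℤ (- k) ≡ parityℤ k
parityℤ-neg k = ≡.cong parity (ℤ.∣-i∣≡∣i∣ k)

module PeriodicMaps {c ℓ₁ ℓ₂} (Ω : TotalOrder c ℓ₁ ℓ₂) where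
  open TotalOrder Ω renaming (Carrier to W)
  open FOn Ω
  open import Algebra.Construct.NaturalChoice.Min Ω
  open import Algebra.Construct.NaturalChoice.Max Ω

  infix 4 _⊣_ _≐_

  _⊣_ : (W → W) → (W → W) → Set (c ⊔ˡ ℓ₂)
  F ⊣ G = ∀ a b → (F a ≤ b → a ≤ G b) × (a ≤ G b → F a ≤ b)

  _≐_ : (W → W) → (W → W) → Set (c ⊔ˡ ℓ₁)
  F ≐ G = ∀ a → F a ≈ G a

  ⊣-monotoneˡ : ∀ {F G} → F ⊣ G → F Preserves _≤_ ⟶ _≤_
  ⊣-monotoneˡ {F} F⊣G {a} {a′} a≤a′ =
    proj₂ (F⊣G a (F a′)) (trans a≤a′ (proj₁ (F⊣G a′ (F a′)) refl))

  ⊣-congˡ : ∀ {F G} → F ⊣ G → F Preserves _≈_ ⟶ _≈_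
  ⊣-congˡ F⊣G a≈a′ = antisym (⊣-monotoneˡ F⊣G (reflexive a≈a′))
                             (⊣-monotoneˡ F⊣G (reflexive (Eq.sym a≈a′)))

  ⊣-antitoneˡ : ∀ {F G F′ G′} → F ⊣ G → F′ ⊣ G′ → (∀ b → G b ≤ G′ b) → ∀ a → F′ a ≤ F a
  ⊣-antitoneˡ {F} F⊣G F′⊣G′ G≤G′ a =
    proj₂ (F′⊣G′ a (F a)) (trans (proj₁ (F⊣G a (F a)) refl) (G≤G′ (F a)))

  ⊣-antitoneʳ : ∀ {F G F′ G′} → F ⊣ G → F′ ⊣ G′ → (∀ a → F a ≤ F′ a) → ∀ b → G′ b ≤ G b
  ⊣-antitoneʳ {G′ = G′} F⊣G F′⊣G′ F≤F′ b =
    proj₁ (F⊣G (G′ b) b) (trans (F≤F′ (G′ b)) (proj₂ (F′⊣G′ (G′ b) b) refl))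

  ⊣-uniqueˡ : ∀ {F G F′ G′} → F ⊣ G → F′ ⊣ G′ → G ≐ G′ → F ≐ F′
  ⊣-uniqueˡ F⊣G F′⊣G′ G≐G′ a = antisym
    (⊣-antitoneˡ F′⊣G′ F⊣G (λ b → reflexive (Eq.sym (G≐G′ b))) a)
    (⊣-antitoneˡ F⊣G F′⊣G′ (λ b → reflexive (G≐G′ b)) a)

  ⊣-uniqueʳ : ∀ {F G F′ G′} → F ⊣ G → F′ ⊣ G′ → F ≐ F′ → G ≐ G′
  ⊣-uniqueʳ F⊣G F′⊣G′ F≐F′ b = antisym
    (⊣-antitoneʳ F′⊣G′ F⊣G (λ a → reflexive (Eq.sym (F≐F′ a))) b)
    (⊣-antitoneʳ F⊣G F′⊣G′ (λ a → reflexive (F≐F′ a)) b)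

  ⊓-⊣-⊔ : ∀ {F G F′ G′} → F ⊣ G → F′ ⊣ G′ → (λ a → F a ⊓ F′ a) ⊣ (λ b → G b ⊔ G′ b)
  ⊓-⊣-⊔ {F} {G} {F′} {G′} F⊣G F′⊣G′ a b = ⇒ , ⇐
    where
    ⇒ : F a ⊓ F′ a ≤ b → a ≤ G b ⊔ G′ b
    ⇒ Fa⊓F′a≤b with ⊓-sel (F a) (F′ a)
    ... | inj₁ ≈Fa  = trans (proj₁ (F⊣G a b) (≤-respˡ-≈ ≈Fa Fa⊓F′a≤b)) (x≤x⊔y (G b) (G′ b))
    ... | inj₂ ≈F′a = trans (proj₁ (F′⊣G′ a b) (≤-respˡ-≈ ≈F′a Fa⊓F′a≤b)) (x≤y⊔x (G b) (G′ b))
    ⇐ : a ≤ G b ⊔ G′ b → F a ⊓ F′ a ≤ b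
    ⇐ a≤Gb⊔G′b with ⊔-sel (G b) (G′ b)
    ... | inj₁ ≈Gb  = x≤y⇒x⊓z≤y (F′ a) (proj₂ (F⊣G a b) (≤-respʳ-≈ ≈Gb a≤Gb⊔G′b))
    ... | inj₂ ≈G′b = x≤y⇒z⊓x≤y (F a) (proj₂ (F′⊣G′ a b) (≤-respʳ-≈ ≈G′b a≤Gb⊔G′b))

  ⊔-⊣-⊓ : ∀ {F G F′ G′} → F ⊣ G → F′ ⊣ G′ → (λ a → F a ⊔ F′ a) ⊣ (λ b → G b ⊓ G′ b)
  ⊔-⊣-⊓ {F} {G} {F′} {G′} F⊣G F′⊣G′ a b =
    (λ Fa⊔F′a≤b → ⊓-glb (proj₁ (F⊣G a b) (x⊔y≤z⇒x≤z (F a) (F′ a) Fa⊔F′a≤b))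
                        (proj₁ (F′⊣G′ a b) (x⊔y≤z⇒y≤z (F a) (F′ a) Fa⊔F′a≤b))) ,
    (λ a≤Gb⊓G′b → ⊔-lub (proj₂ (F⊣G a b) (x≤y⊓z⇒x≤y (G b) (G′ b) a≤Gb⊓G′b))
                        (proj₂ (F′⊣G′ a b) (x≤y⊓z⇒x≤z (G b) (G′ b) a≤Gb⊓G′b)))

  ∘-⊣-∘ : ∀ {F G F′ G′} → F ⊣ G → F′ ⊣ G′ → F ∘ F′ ⊣ G′ ∘ G
  ∘-⊣-∘ {F} {G} {F′} F⊣G F′⊣G′ a b =
    proj₁ (F′⊣G′ a (G b)) ∘ proj₁ (F⊣G (F′ a) b) ,
    proj₂ (F⊣G (F′ a) b) ∘ proj₂ (F′⊣G′ a (G b))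

  BinOp : Set c
  BinOp = (W → W) → (W → W) → W → W

  record Alternation : Set (c ⊔ˡ ℓ₁ ⊔ˡ ℓ₂) where
    field
      op      : Parity → BinOp
      op-⊣    : ∀ p {F G F′ G′} → F ⊣ G → F′ ⊣ G′ → op p F F′ ⊣ op (p ⁻¹) G G′
      op-cong : ∀ p {F F′ H H′} → F Preserves _≈_ ⟶ _≈_ → F′ Preserves _≈_ ⟶ _≈_ →
                F ≐ H → F′ ≐ H′ → op p F F′ ≐ op p H H′

  seq-cong : ∀ f k → seq f k Preserves _≈_ ⟶ _≈_
  seq-cong f k = ⊣-congˡ (adj f k)

  seq-⊣ : ∀ f {i j} → i +ℤ + 1 ≡ j → seq f i ⊣ seq f j
  seq-⊣ f {i} i+1≡j = ≡.subst (λ j → seq f i ⊣ seq f j) i+1≡j (adj f i)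

  alternate : Alternation → FElt → FElt → FElt
  alternate A f g = record { seq = alt ; adj = alt-⊣ }
    where
    open Alternation A
    alt : ℤ → W → W
    alt k = op (parityℤ k) (seq f k) (seq g k)
    alt-⊣ : ∀ k → alt k ⊣ alt (k +ℤ + 1)
    alt-⊣ k = ≡.subst (λ p → alt k ⊣ op p (seq f (k +ℤ + 1)) (seq g (k +ℤ + 1)))
                      (≡.sym (parityℤ-suc k)) (op-⊣ (parityℤ k) (adj f k) (adj g k))

  alternate-periodic : ∀ A n {f g} → PeriodicF n f → PeriodicF n g → PeriodicF n (alternate A f g)
  alternate-periodic A n {f} {g} f-per g-per rewrite parityℤ-neg (+ n) =
    op-cong (parityℤ (+ n)) (seq-cong f (- + n)) (seq-cong g (- + n)) f-per g-per
    where open Alternation A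

  minMax : Parity → BinOp
  minMax 0ℙ F G a = F a ⊓ G a
  minMax 1ℙ F G a = F a ⊔ G a

  maxMin : Parity → BinOp
  maxMin 0ℙ F G a = F a ⊔ G a
  maxMin 1ℙ F G a = F a ⊓ G a

  minMax-alternation : Alternation
  minMax-alternation = record
    { op      = minMax
    ; op-⊣    = λ { 0ℙ → ⊓-⊣-⊔ ; 1ℙ → ⊔-⊣-⊓ }
    ; op-cong = λ { 0ℙ _ _ F≐H F′≐H′ a → ⊓-cong (F≐H a) (F′≐H′ a)
                  ; 1ℙ _ _ F≐H F′≐H′ a → ⊔-cong (F≐H a) (F′≐H′ a) }
    }

  maxMin-alternation : Alternation
  maxMin-alternation = record
    { op      = maxMin
    ; op-⊣    = λ { 0ℙ → ⊔-⊣-⊓ ; 1ℙ → ⊓-⊣-⊔ }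
    ; op-cong = λ { 0ℙ _ _ F≐H F′≐H′ a → ⊔-cong (F≐H a) (F′≐H′ a)
                  ; 1ℙ _ _ F≐H F′≐H′ a → ⊓-cong (F≐H a) (F′≐H′ a) }
    }

  compose : Parity → BinOp
  compose 0ℙ F G = F ∘ G
  compose 1ℙ F G = G ∘ F

  compose-alternation : Alternation
  compose-alternation = record
    { op      = compose
    ; op-⊣    = λ { 0ℙ F⊣G F′⊣G′ → ∘-⊣-∘ F⊣G F′⊣G′ ; 1ℙ F⊣G F′⊣G′ → ∘-⊣-∘ F′⊣G′ F⊣G }
    ; op-cong = λ { 0ℙ F-cong _ F≐H F′≐H′ a → Eq.trans (F-cong (F′≐H′ a)) (F≐H _)
                  ; 1ℙ _ F′-cong F≐H F′≐H′ a → Eq.trans (F′-cong (F≐H a)) (F′≐H′ _) }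
    }

  shift : ℤ → FElt → FElt
  shift d f = record
    { seq = λ k → seq f (k +ℤ d)
    ; adj = λ k → seq-⊣ f (xy∙z≈xz∙y k d (+ 1))
    }

  identity : FElt
  identity = record { seq = λ _ → id ; adj = λ _ _ _ → id , id }

  lad-periodic : ∀ n {f} → PeriodicF n f → PeriodicF n (shift -[1+ 0 ] f)
  lad-periodic n {f} f-per =
    ⊣-uniqueˡ (seq-⊣ f (pred+1≡id (- + n))) (seq-⊣ f (pred+1≡id (+ n))) f-per
    where
    pred+1≡id : ∀ i → (i +ℤ -[1+ 0 ]) +ℤ + 1 ≡ i
    pred+1≡id i = ≡.trans (ℤ.+-assoc i -[1+ 0 ] (+ 1)) (ℤ.+-identityʳ i)

  rad-periodic : ∀ n {f} → PeriodicF n f → PeriodicF n (shift (+ 1) f)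
  rad-periodic n {f} f-per = ⊣-uniqueʳ (adj f (- + n)) (adj f (+ n)) f-per

  periodic-isFSubalgebra : ∀ n → IsFSubalgebra (PeriodicF n)
  periodic-isFSubalgebra n = record
    { ∧-closed   = λ {f} {g} f-per g-per → alternate minMax-alternation f g ,
        (λ a → x⊓y≤x _ _ , x⊓y≤y _ _ , λ _ → ⊓-glb) ,
        alternate-periodic minMax-alternation n {f} {g} f-per g-per
    ; ∨-closed   = λ {f} {g} f-per g-per → alternate maxMin-alternation f g ,
        (λ a → x≤x⊔y _ _ , x≤y⊔x _ _ , λ _ → ⊔-lub) ,
        alternate-periodic maxMin-alternation n {f} {g} f-per g-per
    ; ∘-closed   = λ {f} {g} f-per g-per → alternate compose-alternation f g ,
        (λ _ → Eq.refl) , alternate-periodic compose-alternation n {f} {g} f-per g-per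
    ; id-closed  = identity , (λ _ → Eq.refl) , (λ _ → Eq.refl)
    ; lad-closed = λ {f} f-per → shift -[1+ 0 ] f , (λ _ → Eq.refl) , lad-periodic n {f} f-per
    ; rad-closed = λ {f} f-per → shift (+ 1) f , (λ _ → Eq.refl) , rad-periodic n {f} f-per
    }

open import Data.Nat using (_≤_)

lemma2p6 : ∀ {c ℓ c′ ℓ₁ ℓ₂} (n : ℕ) → 1 ≤ n →
    ((A : LPregroup c ℓ) →
      LPregroup.IsSubalgebra A (LPregroup.Periodic A n))
    × ((Ω : TotalOrder c′ ℓ₁ ℓ₂) →
      FOn.IsFSubalgebra Ω (FOn.PeriodicF Ω n))
lemma2p6 n _ =
  (λ A → PeriodicElements.periodic-isSubalgebra A n) ,
  (λ Ω → PeriodicMaps.periodic-isFSubalgebra Ω n)
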